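{- Let $V(n)$ denote the number of integers $a$ with $1\le a\le n$ that are regular modulo $n$, and let $\mathcal{A}=\{n\in\mathbb{N}: V(n+1)/V(n)>1\}$ and $\mathcal{B}=\{n\in\mathbb{N}: V(n+1)/V(n)<1\}$. Then $$\liminf_{\substack{n\to\infty\\ n\in\mathcal{A}}}\frac{V(n+1)}{V(n)}=1\qquad\text{and}\qquad \limsup_{\substack{n\to\infty\\ n\in\mathcal{B}}}\frac{V(n+1)}{V(n)}=1.$$
   Context: For a positive integer $n$, an integer $a$ is called regular modulo $n$ if there exists an integer $x$ such that $a^{2}x\equiv a \pmod n$. $V(n)=\#\{a: 1\le a\le n,\ a \text{ regular modulo } n\}$. -}

module Defs where

open import Data.Nat as ℕ using (ℕ; zero; suc)
open import Data.Integer as ℤ using (ℤ; +_; _+_; _*_; _-_)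
open import Data.Integer.DivMod using (_%_; _/_; a≡a%n+[a/n]*n; n%d<d)
open import Data.Integer.Divisibility.Signed using (_∣_; _∣?_; ∣m+n∣n⇒∣m; ∣n⇒∣m*n; ∣-refl)
open import Data.Integer.Tactic.RingSolver using (solve-∀)
open import Data.Fin as Fin using (Fin; toℕ; fromℕ<)
open import Data.Fin.Properties using (any?; toℕ-fromℕ<)
open import Data.Product using (Σ; ∃; ∃-syntax; _,_)
open import Data.List using (List; length; filter; applyUpTo)
open import Relation.Nullary using (Dec; yes; no)
open import Relation.Binary.PropositionalEquality using (_≡_; refl; cong; sym; trans; subst)

Regular : ℕ → ℕ → Set
Regular n a = ∃[ x ] (+ n) ∣ ((+ a) * (+ a) * x - (+ a))

-- Helper: decidability of regularity (needed to count); the witness can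
-- be reduced modulo n.
private

  key′ : ∀ (A r q N : ℤ) →
        A * A * (r + q * N) - A ≡ (A * A * r - A) + (A * A * q) * N
  key′ = solve-∀

  key : ∀ (A x r q N : ℤ) → x ≡ r + q * N →
        A * A * x - A ≡ (A * A * r - A) + (A * A * q) * N
  key A x r q N refl = key′ A r q N

  reduce : ∀ m a → Regular (suc m) a →
           ∃[ i ] (+ suc m) ∣ ((+ a) * (+ a) * (+ toℕ {suc m} i) - (+ a))
  reduce m a (x , d) = fromℕ< (n%d<d x (+ suc m)) , d′
    where
      N = + suc m
      A = + a
      q = x / N
      eq : x ≡ + toℕ (fromℕ< (n%d<d x N)) + q * N
      eq = subst (λ k → x ≡ + k + q * N) (sym (toℕ-fromℕ< (n%d<d x N))) (a≡a%n+[a/n]*n x N)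
      d′ : N ∣ (A * A * (+ toℕ (fromℕ< (n%d<d x N))) - A)
      d′ = ∣m+n∣n⇒∣m (subst (N ∣_) (key A x _ q N eq) d) (∣n⇒∣m*n (A * A * q) ∣-refl)

regular? : ∀ m a → Dec (Regular (suc m) a)
regular? m a with any? (λ (i : Fin (suc m)) → (+ suc m) ∣? ((+ a) * (+ a) * (+ toℕ i) - (+ a)))
... | yes (i , d) = yes (+ toℕ i , d)
... | no ¬p = no λ r → ¬p (reduce m a r)

V : ℕ → ℕ
V zero = 0
V (suc m) = length (filter (regular? m) (applyUpTo suc (suc m)))

{-# OPTIONS --safe #-}
-- If n is squarefree, every a is regular modulo n, so V(n) = n.  Sieving the progressions
-- 1 + 36k and 2 + 36k by the squares d² with 5 ≤ d ≤ 2r² over the window r³ ≤ k < 2r³ leaves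
-- an unsieved k, since the struck k number at most Σ 2 (r³/d² + 1) < r³ while d = 2, 3, 4 are
-- excluded modulo 36; hence n, n + 1 are both squarefree for arbitrarily large n, and
-- V(n+1)/V(n) = (n+1)/n tends to 1 from above.  For a prime t the same sieve applied to
-- 30 + 36k and t²(30 + 36k) − 1 gives squarefree n with n + 1 = t² s, s squarefree.  Modulo
-- t² s every a prime to t is regular while t and 2t are not, so
-- n + 1 − (1 + t s) ≤ V(n+1) ≤ n − 1 = V(n) − 1, and letting t grow the ratio tends to 1 from below.
module Submission where

open import Defs
open import Data.Nat.Base as ℕ using (ℕ)
open import Data.Nat.Divisibility using (_∣_; divides)
open import Data.Nat.Coprimality using (Coprime; coprime-Bézout)
open import Data.Nat.GCD using (module Bézout)
open import Data.Product using (_,_)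
open import Relation.Binary.PropositionalEquality
open import Level using (0ℓ)
open import Function using (_∘_)

module Regularity where

  open import Data.Integer using (ℤ; +_; -_; _+_; _-_; _*_; 1ℤ; ∣_∣)
  open import Data.Integer.Properties using (pos-*; pos-+; abs-*; *-cancelˡ-≡)
  import Data.Nat.Properties as ℕ
  open import Data.Integer.Divisibility.Signed using (divides)
  open import Data.Integer.Tactic.RingSolver using (solve-∀)
  open ≡-Reasoning

  -- If x a = 1 + y h and a = q g, then a² x − a = a (x a − 1) = q y (g h).
  private
    witness⁺ : ∀ A X Y H Q G → X * A ≡ 1ℤ + Y * H → A ≡ Q * G →
               A * A * X - A ≡ Q * Y * (G * H)
    witness⁺ A X Y H Q G xa≡1+yh refl = begin
      A * A * X - A               ≡⟨ expand A X ⟩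
      A * (X * A) - A             ≡⟨ cong (λ z → A * z - A) xa≡1+yh ⟩
      Q * G * (1ℤ + Y * H) - Q * G ≡⟨ collect Q G Y H ⟩
      Q * Y * (G * H)             ∎
      where
      expand : ∀ A X → A * A * X - A ≡ A * (X * A) - A
      expand = solve-∀
      collect : ∀ Q G Y H → Q * G * (1ℤ + Y * H) - Q * G ≡ Q * Y * (G * H)
      collect = solve-∀

    witness⁻ : ∀ A X Y H Q G → 1ℤ + X * A ≡ Y * H → A ≡ Q * G →
               A * A * (- X) - A ≡ - (Q * Y) * (G * H)
    witness⁻ A X Y H Q G 1+xa≡yh refl = begin
      A * A * (- X) - A       ≡⟨ expand A X ⟩
      - (A * (1ℤ + X * A))    ≡⟨ cong (λ z → - (A * z)) 1+xa≡yh ⟩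
      - (Q * G * (Y * H))     ≡⟨ collect Q G Y H ⟩
      - (Q * Y) * (G * H)     ∎
      where
      expand : ∀ A X → A * A * (- X) - A ≡ - (A * (1ℤ + X * A))
      expand = solve-∀
      collect : ∀ Q G Y H → - (Q * G * (Y * H)) ≡ - (Q * Y) * (G * H)
      collect = solve-∀

    pos-1+* : ∀ m n → + (1 ℕ.+ m ℕ.* n) ≡ 1ℤ + + m * + n
    pos-1+* m n = trans (pos-+ 1 (m ℕ.* n)) (cong (λ z → 1ℤ + z) (pos-* m n))

  regular-of-coprime-cofactor : ∀ {g h a} → g ∣ a → Coprime a h → Regular (g ℕ.* h) a
  regular-of-coprime-cofactor {g} {h} {a} (divides q a≡qg) a⊥h with coprime-Bézout a⊥h
  ... | Bézout.+- x y 1+yh≡xa = + x , divides (+ q * + y)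
        (trans (witness⁺ (+ a) (+ x) (+ y) (+ h) (+ q) (+ g) xa≡1+yh a≡qg′)
               (cong (+ q * + y *_) (sym (pos-* g h))))
    where
    xa≡1+yh : + x * + a ≡ 1ℤ + + y * + h
    xa≡1+yh = trans (sym (pos-* x a)) (trans (cong +_ (sym 1+yh≡xa)) (pos-1+* y h))
    a≡qg′ : + a ≡ + q * + g
    a≡qg′ = trans (cong +_ a≡qg) (pos-* q g)
  ... | Bézout.-+ x y 1+xa≡yh = - + x , divides (- (+ q * + y))
        (trans (witness⁻ (+ a) (+ x) (+ y) (+ h) (+ q) (+ g) 1+xa≡yh′ a≡qg′)
               (cong (- (+ q * + y) *_) (sym (pos-* g h))))
    where
    1+xa≡yh′ : 1ℤ + + x * + a ≡ + y * + h
    1+xa≡yh′ = trans (sym (pos-1+* x a)) (trans (cong +_ 1+xa≡yh) (pos-* y h))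
    a≡qg′ : + a ≡ + q * + g
    a≡qg′ = trans (cong +_ a≡qg) (pos-* q g)

  -- (c t)² x − c t = q t² s forces c = t (c² x − q s).
  regular-multiple⇒∣ : ∀ {t s c} .{{_ : ℕ.NonZero t}} → Regular (t ℕ.* t ℕ.* s) (c ℕ.* t) → t ∣ c
  regular-multiple⇒∣ {t} {s} {c} (X , divides q eq) =
    divides ∣ w ∣ (trans (cong ∣_∣ C≡Tw) (trans (abs-* T w) (ℕ.*-comm t ∣ w ∣)))
    where
    C T S w : ℤ
    C = + c
    T = + t
    S = + s
    w = C * C * X - q * S
    eq′ : C * T * (C * T) * X - C * T ≡ q * (T * T * S)
    eq′ = subst₂ (λ u v → u * u * X - u ≡ q * v) (pos-* c t)
                 (trans (pos-* (t ℕ.* t) s) (cong (_* S) (pos-* t t))) eq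
    factorˡ : ∀ C T X → C * T * (C * T) * X - C * T ≡ T * (C * C * T * X - C)
    factorˡ = solve-∀
    factorʳ : ∀ q T S → q * (T * T * S) ≡ T * (q * T * S)
    factorʳ = solve-∀
    cancelled : C * C * T * X - C ≡ q * T * S
    cancelled = *-cancelˡ-≡ T _ _ (trans (sym (factorˡ C T X)) (trans eq′ (factorʳ q T S)))
    C≡Tw : C ≡ T * w
    C≡Tw = begin
      C                               ≡⟨ double-negation C (C * C * T * X) ⟩
      C * C * T * X - (C * C * T * X - C) ≡⟨ cong (λ z → C * C * T * X - z) cancelled ⟩
      C * C * T * X - q * T * S       ≡⟨ factor C T X q S ⟩
      T * w                           ∎
      where
      double-negation : ∀ C Y → C ≡ Y - (Y - C)
      double-negation = solve-∀
      factor : ∀ C T X q S → C * C * T * X - q * T * S ≡ T * (C * C * X - q * S)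
      factor = solve-∀

open Regularity

open import Data.Nat
open import Data.Nat.Properties
open import Data.Nat.Divisibility
open import Data.Nat.Coprimality as Coprime using (coprime-divisor)
open import Data.Nat.DivMod
open import Data.Nat.GCD using (gcd; gcd[m,n]∣m; gcd[m,n]∣n; gcd-greatest; gcd[m,n]≢0)
open import Data.Nat.Primality using (Prime; prime⇒irreducible; prime⇒nonZero; prime⇒nonTrivial; prime[2]; prime?)
open import Data.Nat.Primality.Factorisation using (factorise; PrimeFactorisation)
open import Data.List.Relation.Unary.All using (All; _∷_)
open import Data.Product using (_×_; ∃-syntax)
open import Data.Sum using (_⊎_; inj₁; inj₂)
open import Data.Empty using (⊥; ⊥-elim)
open import Data.Nat.Tactic.RingSolver using (solve-∀)
open import Data.List using (List; []; _∷_; length; filter; applyUpTo)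
open import Data.Nat.ListAction using (product)
open import Relation.Nullary using (¬_; yes; no)
open import Relation.Nullary.Decidable using (¬?; _⊎-dec_; from-yes; from-no)
open import Relation.Unary using (Pred; Decidable)

Squarefree : ℕ → Set
Squarefree m = ∀ d → d * d ∣ m → d ≡ 1

coprime-prime : ∀ {p d} → Prime p → ¬ p ∣ d → Coprime d p
coprime-prime p-prime p∤d (c∣d , c∣p) with prime⇒irreducible p-prime c∣p
... | inj₁ c≡1 = c≡1
... | inj₂ refl = ⊥-elim (p∤d c∣d)

coprime-* : ∀ {m n o} → Coprime m n → Coprime m o → Coprime m (n * o)
coprime-* m⊥n m⊥o (c∣m , c∣no) =
  m⊥o (c∣m , coprime-divisor (λ (e∣c , e∣n) → m⊥n (∣-trans e∣c c∣m , e∣n)) c∣no)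

coprime-square : ∀ {m n} → Coprime m n → Coprime (m * m) n
coprime-square m⊥n = Coprime.sym (coprime-* (Coprime.sym m⊥n) (Coprime.sym m⊥n))

∤-of-∣suc : ∀ {p f} → Prime p → p ∣ suc f → ¬ p ∣ f
∤-of-∣suc {p} {f} p-prime p∣1+f p∣f =
  nonTrivial⇒≢1 {{prime⇒nonTrivial p-prime}} (∣1⇒≡1 (∣m+n∣m⇒∣n (subst (p ∣_) (+-comm 1 f) p∣1+f) p∣f))

coprime-of-∣suc : ∀ {p d f} → Prime p → p ∣ suc f → d * d ∣ f → Coprime d p
coprime-of-∣suc {d = d} p-prime p∣1+f d²∣f =
  coprime-prime p-prime λ p∣d → ∤-of-∣suc p-prime p∣1+f (∣-trans (∣-trans p∣d (m∣m*n d)) d²∣f)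

coprime-of-∤square : ∀ {p d f} → Prime p → d * d ∣ f → ¬ p * p ∣ f → Coprime d p
coprime-of-∤square p-prime d²∣f p²∤f = coprime-prime p-prime λ p∣d → p²∤f (∣-trans (*-pres-∣ p∣d p∣d) d²∣f)

prime[3] : Prime 3
prime[3] = from-yes (prime? 3)

coprime-36 : ∀ {d} → Coprime d 2 → Coprime d 3 → Coprime d 36
coprime-36 d⊥2 d⊥3 = coprime-* d⊥2 (coprime-* d⊥2 (coprime-* d⊥3 d⊥3))

m≤n⇒m∣n! : ∀ {m n} .{{_ : NonZero m}} → m ≤ n → m ∣ n !
m≤n⇒m∣n! {suc m} m≤n = ∣-trans (m∣m*n (m !)) (m≤n⇒m!∣n! m≤n)

squarefree⇒nonZero : ∀ {m} → Squarefree m → NonZero m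
squarefree⇒nonZero {zero} sf with sf 2 (4 ∣0)
... | ()
squarefree⇒nonZero {suc m} sf = _

noCommonSquare⇒regular : ∀ m a .{{_ : NonZero m}} → (∀ c → c ∣ a → c * c ∣ m → c ≡ 1) → Regular m a
noCommonSquare⇒regular m a noSquare =
  subst (λ n → Regular n a) (m*[n/m]≡n g∣m) (regular-of-coprime-cofactor (gcd[m,n]∣m a m) a⊥m/g)
  where
  g : ℕ
  g = gcd a m
  g∣m : g ∣ m
  g∣m = gcd[m,n]∣n a m
  instance
    g≢0 : NonZero g
    g≢0 = ≢-nonZero (gcd[m,n]≢0 a m (inj₂ (≢-nonZero⁻¹ m)))
  a⊥m/g : Coprime a (m / g)
  a⊥m/g {c} (c∣a , c∣m/g) = noSquare c c∣a (subst (c * c ∣_) (m*[n/m]≡n g∣m)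
    (*-pres-∣ (gcd-greatest c∣a (∣-trans c∣m/g (m/n∣m g∣m))) c∣m/g))

squarefree⇒regular : ∀ {m} → Squarefree m → ∀ a → Regular m a
squarefree⇒regular {m} sf a = noCommonSquare⇒regular m a {{squarefree⇒nonZero sf}} (λ c _ c²∣m → sf c c²∣m)

regular-of-coprime-prime : ∀ {t s a} → Prime t → Squarefree s → ¬ t ∣ a → Regular (t * t * s) a
regular-of-coprime-prime {t} {s} {a} t-prime s-sf t∤a = noCommonSquare⇒regular (t * t * s) a {{t²s≢0}}
  (λ c c∣a c²∣t²s → s-sf c (coprime-divisor (coprime-square (coprime-* (c⊥t c∣a) (c⊥t c∣a))) c²∣t²s))
  where
  instance
    t≢0 : NonZero t
    t≢0 = prime⇒nonZero t-prime
    s≢0 : NonZero s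
    s≢0 = squarefree⇒nonZero s-sf
  t²s≢0 : NonZero (t * t * s)
  t²s≢0 = m*n≢0 (t * t) s {{m*n≢0 t t}}
  c⊥t : ∀ {c} → c ∣ a → Coprime c t
  c⊥t c∣a = coprime-prime t-prime (λ t∣c → t∤a (∣-trans t∣c c∣a))

module _ {P : Pred ℕ 0ℓ} (P? : Decidable P) where

  count : ℕ → ℕ → ℕ
  count K zero = 0
  count K (suc L) with P? K
  ... | yes _ = suc (count (suc K) L)
  ... | no  _ = count (suc K) L

  count-+ : ∀ K L L′ → count K (L + L′) ≡ count K L + count (K + L) L′
  count-+ K zero L′ = cong (λ k → count k L′) (sym (+-identityʳ K))
  count-+ K (suc L) L′ with P? K
  ... | yes _ = cong suc (trans (count-+ (suc K) L L′) (cong (λ k → count (suc K) L + count k L′) (sym (+-suc K L))))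
  ... | no  _ = trans (count-+ (suc K) L L′) (cong (λ k → count (suc K) L + count k L′) (sym (+-suc K L)))

  count-monoʳ-≤ : ∀ K {L L′} → L ≤ L′ → count K L ≤ count K L′
  count-monoʳ-≤ K {L} {L′} L≤L′ = begin
    count K L                              ≤⟨ m≤m+n (count K L) _ ⟩
    count K L + count (K + L) (L′ ∸ L)     ≡⟨ count-+ K L (L′ ∸ L) ⟨
    count K (L + (L′ ∸ L))                 ≡⟨ cong (count K) (m+[n∸m]≡n L≤L′) ⟩
    count K L′                             ∎
    where open ≤-Reasoning

  count-all : ∀ K L → (∀ i → i < L → P (K + i)) → count K L ≡ L
  count-all K zero _ = refl
  count-all K (suc L) all with P? K
  ... | yes _ = cong suc (count-all (suc K) L λ i i<L → subst P (+-suc K i) (all (suc i) (s≤s i<L)))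
  ... | no ¬p = ⊥-elim (¬p (subst P (+-identityʳ K) (all 0 z<s)))

  count-none : ∀ K L → (∀ i → i < L → ¬ P (K + i)) → count K L ≡ 0
  count-none K zero _ = refl
  count-none K (suc L) none with P? K
  ... | yes p = ⊥-elim (none 0 z<s (subst P (sym (+-identityʳ K)) p))
  ... | no  _ = count-none (suc K) L λ i i<L → none (suc i) (s≤s i<L) ∘ subst P (sym (+-suc K i))

  count-witness : ∀ K L a → K ≤ a → a < K + L → P a → 1 ≤ count K L
  count-witness K zero a K≤a a<K+0 _ = ⊥-elim (<⇒≱ a<K+0 (≤-trans (≤-reflexive (+-identityʳ K)) K≤a))
  count-witness K (suc L) a K≤a a<K+1+L p with P? K | m≤n⇒m<n∨m≡n K≤a
  ... | yes _ | _         = s≤s z≤n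
  ... | no ¬p | inj₂ refl = ⊥-elim (¬p p)
  ... | no  _ | inj₁ K<a  = count-witness (suc K) L a K<a (subst (a <_) (+-suc K L) a<K+1+L) p

  count-witness₂ : ∀ K L a b → K ≤ a → a < b → b < K + L → P a → P b → 2 ≤ count K L
  count-witness₂ K zero a b K≤a a<b b<K+0 _ _ =
    ⊥-elim (<⇒≱ b<K+0 (≤-trans (≤-reflexive (+-identityʳ K)) (≤-trans K≤a (<⇒≤ a<b))))
  count-witness₂ K (suc L) a b K≤a a<b b<K+1+L pa pb with P? K | m≤n⇒m<n∨m≡n K≤a
  ... | yes _ | _         = s≤s (count-witness (suc K) L b (≤-<-trans K≤a a<b) b<1+K+L pb)
    where
    b<1+K+L : b < suc K + L
    b<1+K+L = subst (b <_) (+-suc K L) b<K+1+L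
  ... | no ¬p | inj₂ refl = ⊥-elim (¬p pa)
  ... | no  _ | inj₁ K<a  = count-witness₂ (suc K) L a b K<a a<b (subst (b <_) (+-suc K L) b<K+1+L) pa pb

  count<⇒∃¬ : ∀ K L → count K L < L → ∃[ i ] (i < L × ¬ P (K + i))
  count<⇒∃¬ K (suc L) c<L with P? K
  ... | no ¬p = 0 , z<s , ¬p ∘ subst P (+-identityʳ K)
  ... | yes _ with count<⇒∃¬ (suc K) L (≤-pred c<L)
  ...   | i , i<L , ¬p = suc i , s≤s i<L , ¬p ∘ subst P (+-suc K i)

  length-filter-applyUpTo : ∀ f K L → (∀ i → f i ≡ i + K) → length (filter P? (applyUpTo f L)) ≡ count K L
  length-filter-applyUpTo f K zero _ = refl
  length-filter-applyUpTo f K (suc L) f≗ with f 0 | f≗ 0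
  ... | _ | refl with P? K
  ...   | yes _ = cong suc rest
    where
    rest : length (filter P? (applyUpTo (f ∘ suc) L)) ≡ count (suc K) L
    rest = length-filter-applyUpTo (f ∘ suc) (suc K) L λ i → trans (f≗ (suc i)) (sym (+-suc i K))
  ...   | no  _ = length-filter-applyUpTo (f ∘ suc) (suc K) L λ i → trans (f≗ (suc i)) (sym (+-suc i K))

module _ {P Q : Pred ℕ 0ℓ} (P? : Decidable P) (Q? : Decidable Q) where

  count-mono : (∀ {k} → P k → Q k) → ∀ K L → count P? K L ≤ count Q? K L
  count-mono P⊆Q K zero = z≤n
  count-mono P⊆Q K (suc L) with P? K | Q? K
  ... | yes _ | yes _ = s≤s (count-mono P⊆Q (suc K) L)
  ... | yes p | no ¬q = ⊥-elim (¬q (P⊆Q p))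
  ... | no  _ | yes _ = m≤n⇒m≤1+n (count-mono P⊆Q (suc K) L)
  ... | no  _ | no  _ = count-mono P⊆Q (suc K) L

  count-∪ : ∀ K L → count (λ k → P? k ⊎-dec Q? k) K L ≤ count P? K L + count Q? K L
  count-∪ K zero = z≤n
  count-∪ K (suc L) with P? K | Q? K | count-∪ (suc K) L
  ... | yes _ | yes _ | ih = s≤s (≤-trans ih (+-monoʳ-≤ _ (n≤1+n _)))
  ... | yes _ | no  _ | ih = s≤s ih
  ... | no  _ | yes _ | ih = ≤-trans (s≤s ih) (≤-reflexive (sym (+-suc _ _)))
  ... | no  _ | no  _ | ih = ih

count-complement : ∀ {P : Pred ℕ 0ℓ} (P? : Decidable P) K L → count P? K L + count (¬? ∘ P?) K L ≡ L
count-complement P? K zero = refl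
count-complement P? K (suc L) with P? K
... | yes _ = cong suc (count-complement P? (suc K) L)
... | no  _ = trans (+-suc _ _) (cong suc (count-complement P? (suc K) L))

Spaced : ℕ → Pred ℕ 0ℓ → Set
Spaced M P = ∀ k δ → P k → P (k + suc δ) → M ≤ suc δ

module _ {P : Pred ℕ 0ℓ} (P? : Decidable P) {M} (spaced : Spaced M P) where

  count-spaced-≤1 : ∀ K L → L ≤ M → count P? K L ≤ 1
  count-spaced-≤1 K zero _ = z≤n
  count-spaced-≤1 K (suc L) 1+L≤M with P? K
  ... | yes p = s≤s (≤-reflexive (count-none P? (suc K) L λ i i<L q →
                  <⇒≱ (≤-trans (s≤s i<L) 1+L≤M) (spaced K i p (subst P (sym (+-suc K i)) q))))
  ... | no  _ = count-spaced-≤1 (suc K) L (≤-trans (n≤1+n L) 1+L≤M)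

  count-spaced-blocks : ∀ K q → count P? K (q * M) ≤ q
  count-spaced-blocks K zero = z≤n
  count-spaced-blocks K (suc q) = begin
    count P? K (M + q * M)                   ≡⟨ count-+ P? K M (q * M) ⟩
    count P? K M + count P? (K + M) (q * M)  ≤⟨ +-mono-≤ (count-spaced-≤1 K M ≤-refl) (count-spaced-blocks (K + M) q) ⟩
    1 + q                                    ∎
    where open ≤-Reasoning

  count-spaced : .{{_ : NonZero M}} → ∀ K L → count P? K L ≤ 1 + L / M
  count-spaced K L = begin
    count P? K L                   ≤⟨ count-monoʳ-≤ P? K L≤ ⟩
    count P? K ((1 + L / M) * M)   ≤⟨ count-spaced-blocks K (1 + L / M) ⟩
    1 + L / M                      ∎
    where
    open ≤-Reasoning
    L≤ : L ≤ (1 + L / M) * M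
    L≤ = begin
      L                    ≡⟨ m≡m%n+[m/n]*n L M ⟩
      L % M + L / M * M    ≤⟨ +-monoˡ-≤ (L / M * M) (m%n≤n L M) ⟩
      (1 + L / M) * M      ∎

∣-progression-spaced : ∀ b A M → (∀ k → M ∣ b + A * k → Coprime M A) → Spaced M (λ k → M ∣ b + A * k)
∣-progression-spaced b A M coprime k δ M∣bk M∣bkδ =
  ∣⇒≤ (coprime-divisor (coprime k M∣bk) (∣m+n∣m⇒∣n (subst (M ∣_) (shift b A k) M∣bkδ) M∣bk))
  where
  shift : ∀ b A k → b + A * (k + suc δ) ≡ b + A * k + A * suc δ
  shift b A k = trans (cong (b +_) (*-distribˡ-+ A k (suc δ))) (sym (+-assoc b (A * k) (A * suc δ)))

m*n≤o⇒m≤o/n : ∀ m n o .{{_ : NonZero n}} → m * n ≤ o → m ≤ o / n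
m*n≤o⇒m≤o/n m n o mn≤o = subst (_≤ o / n) (m*n/n≡m m n) (/-monoˡ-≤ n mn≤o)

-- The floor-division form of 1/(n+1) + 1/(n+1)² ≤ 1/n; it makes the sieve bound telescope.
m/[1+n]+m/[1+n]/[1+n]≤m/n : ∀ m n .{{_ : NonZero n}} → m / suc n + m / suc n / suc n ≤ m / n
m/[1+n]+m/[1+n]/[1+n]≤m/n m n = m*n≤o⇒m≤o/n (q + q / suc n) n m (begin
  (q + q / suc n) * n          ≡⟨ *-distribʳ-+ n q (q / suc n) ⟩
  q * n + q / suc n * n        ≤⟨ +-monoʳ-≤ (q * n) (≤-trans (*-monoʳ-≤ (q / suc n) (n≤1+n n)) (m/n*n≤m q (suc n))) ⟩
  q * n + q                    ≡⟨ trans (*-suc q n) (+-comm q (q * n)) ⟨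
  q * suc n                    ≤⟨ m/n*n≤m m (suc n) ⟩
  m                            ∎)
  where
  open ≤-Reasoning
  q : ℕ
  q = m / suc n

module Sieve (Q : ℕ → Pred ℕ 0ℓ) (Q? : ∀ d → Decidable (Q d))
  (count-Q : ∀ e K L → count (Q? (5 + e)) K L ≤ 2 * (1 + L / (5 + e) / (5 + e))) where

  Struck : ℕ → Pred ℕ 0ℓ
  Struck zero    k = ⊥
  Struck (suc e) k = Struck e k ⊎ Q (5 + e) k

  struck? : ∀ e → Decidable (Struck e)
  struck? zero    k = no λ ()
  struck? (suc e) k = struck? e k ⊎-dec Q? (5 + e) k

  count-struck : ∀ e K L → count (struck? e) K L + 2 * (L / (4 + e)) ≤ 2 * (L / 4) + 2 * e
  count-struck zero K L = ≤-reflexive (begin-equality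
    count (struck? 0) K L + 2 * (L / 4) ≡⟨ cong (_+ 2 * (L / 4)) (count-none (struck? 0) K L λ _ _ ()) ⟩
    2 * (L / 4)                         ≡⟨ +-identityʳ (2 * (L / 4)) ⟨
    2 * (L / 4) + 2 * 0                 ∎)
    where open ≤-Reasoning
  count-struck (suc e) K L = begin
    count (struck? (suc e)) K L + 2 * (L / (5 + e))
      ≤⟨ +-monoˡ-≤ _ (count-∪ (struck? e) (Q? (5 + e)) K L) ⟩
    c + count (Q? (5 + e)) K L + 2 * (L / (5 + e))
      ≤⟨ +-monoˡ-≤ _ (+-monoʳ-≤ c (count-Q e K L)) ⟩
    c + 2 * (1 + L / (5 + e) / (5 + e)) + 2 * (L / (5 + e))
      ≡⟨ rearrange c (L / (5 + e) / (5 + e)) (L / (5 + e)) ⟩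
    c + 2 * (L / (5 + e) + L / (5 + e) / (5 + e)) + 2
      ≤⟨ +-monoˡ-≤ 2 (+-monoʳ-≤ c (*-monoʳ-≤ 2 (m/[1+n]+m/[1+n]/[1+n]≤m/n L (4 + e)))) ⟩
    c + 2 * (L / (4 + e)) + 2
      ≤⟨ +-monoˡ-≤ 2 (count-struck e K L) ⟩
    2 * (L / 4) + 2 * e + 2
      ≡⟨ shift (2 * (L / 4)) e ⟩
    2 * (L / 4) + 2 * suc e ∎
    where
    open ≤-Reasoning
    c : ℕ
    c = count (struck? e) K L
    rearrange : ∀ c x y → c + 2 * (1 + x) + 2 * y ≡ c + 2 * (y + x) + 2
    rearrange = solve-∀
    shift : ∀ a e → a + 2 * e + 2 ≡ a + 2 * suc e
    shift = solve-∀

  ¬struck : ∀ e {k} → ¬ Struck e k → ∀ d → 5 ≤ d → d ≤ 4 + e → ¬ Q d k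
  ¬struck (suc e) ¬s d 5≤d d≤5+e q with m≤n⇒m<n∨m≡n d≤5+e
  ... | inj₁ d<5+e = ¬struck e (¬s ∘ inj₁) d 5≤d (≤-pred d<5+e) q
  ... | inj₂ refl  = ¬s (inj₂ q)
  ¬struck zero ¬s d 5≤d d≤4 = ⊥-elim (<⇒≱ 5≤d d≤4)

  sieve : ∀ K L D → 4 * D < L → ∃[ i ] (i < L × ∀ d → 5 ≤ d → d ≤ D → ¬ Q d (K + i))
  sieve K L D 4D<L with count<⇒∃¬ (struck? e) K L struck<L
    where
    e c : ℕ
    e = D ∸ 4
    c = count (struck? e) K L
    c≤ : c ≤ 2 * (L / 4) + 2 * e
    c≤ = ≤-trans (m≤m+n c _) (count-struck e K L)
    struck<L : c < L
    struck<L = *-cancelˡ-< 2 c L (begin-strict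
      2 * c                             ≤⟨ *-monoʳ-≤ 2 c≤ ⟩
      2 * (2 * (L / 4) + 2 * e)         ≡⟨ double (L / 4) e ⟩
      4 * (L / 4) + 4 * e               <⟨ +-mono-≤-< (subst (_≤ L) (*-comm (L / 4) 4) (m/n*n≤m L 4))
                                                      (≤-<-trans (*-monoʳ-≤ 4 (m∸n≤m D 4)) 4D<L) ⟩
      L + L                             ≡⟨ cong (L +_) (+-identityʳ L) ⟨
      2 * L                             ∎)
      where
      open ≤-Reasoning
      double : ∀ x e → 2 * (2 * x + 2 * e) ≡ 4 * x + 4 * e
      double = solve-∀
  ... | i , i<L , ¬s = i , i<L , λ d 5≤d d≤D →
        ¬struck (D ∸ 4) ¬s d 5≤d (≤-trans d≤D (m≤n+m∸n D 4))

squarefree-if-no-small-square : ∀ {f} D → 5 ≤ D → f < D * D → ¬ 4 ∣ f → ¬ 9 ∣ f →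
                                (∀ d → 5 ≤ d → d ≤ D → ¬ d * d ∣ f) → Squarefree f
squarefree-if-no-small-square {f} D 5≤D f<D² 4∤f 9∤f no-square = square-divisor
  where
  instance
    f≢0 : NonZero f
    f≢0 = ≢-nonZero λ { refl → no-square 5 ≤-refl 5≤D (25 ∣0) }
  square-divisor : Squarefree f
  square-divisor 0 0∣f = ⊥-elim (≢-nonZero⁻¹ f (0∣⇒≡0 0∣f))
  square-divisor 1 _ = refl
  square-divisor 2 4∣f = ⊥-elim (4∤f 4∣f)
  square-divisor 3 9∣f = ⊥-elim (9∤f 9∣f)
  square-divisor 4 16∣f = ⊥-elim (4∤f (∣-trans (divides 4 refl) 16∣f))
  square-divisor d@(suc (suc (suc (suc (suc _))))) d²∣f with d ≤? D
  ... | yes d≤D = ⊥-elim (no-square d (s≤s (s≤s (s≤s (s≤s (s≤s z≤n))))) d≤D d²∣f)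
  ... | no  d≰D = ⊥-elim (<⇒≱ f<D² (≤-trans (*-mono-≤ D≤d D≤d) (∣⇒≤ d²∣f)))
    where
    D≤d : D ≤ d
    D≤d = <⇒≤ (≰⇒> d≰D)

4*[2*r*r]<r*r*r : ∀ r → 8 < r → 4 * (2 * (r * r)) < r * r * r
4*[2*r*r]<r*r*r r@(suc _) 8<r = begin-strict
  4 * (2 * (r * r)) ≡⟨ *-assoc 4 2 (r * r) ⟨
  8 * (r * r)       <⟨ *-monoˡ-< (r * r) 8<r ⟩
  r * (r * r)       ≡⟨ *-assoc r r r ⟨
  r * r * r         ∎
  where open ≤-Reasoning

b+A*k<[2*r*r]² : ∀ r {b A k} → b < r → A ≤ r → k < r * r * r + r * r * r → b + A * k < 2 * (r * r) * (2 * (r * r))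
b+A*k<[2*r*r]² r@(suc _) {b} {A} {k} b<r A≤r k<2L = begin-strict
  b + A * k                  <⟨ +-mono-<-≤ b<r (*-mono-≤ A≤r (<⇒≤ k<2L)) ⟩
  r + r * (L + L)            ≤⟨ +-monoˡ-≤ (r * (L + L)) (m≤m*n r (L + L)) ⟩
  r * (L + L) + r * (L + L)  ≡⟨ expand r ⟨
  2 * (r * r) * (2 * (r * r)) ∎
  where
  open ≤-Reasoning
  L : ℕ
  L = r * r * r
  expand : ∀ r → 2 * (r * r) * (2 * (r * r)) ≡ r * (r * r * r + r * r * r) + r * (r * r * r + r * r * r)
  expand = solve-∀

record Admissible (b A : ℕ) : Set where
  field
    4∤ : ∀ k → ¬ 4 ∣ b + A * k
    9∤ : ∀ k → ¬ 9 ∣ b + A * k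
    coprime : ∀ d k → d * d ∣ b + A * k → Coprime d A

count-square-divides : ∀ {b A} → Admissible b A → ∀ d .{{_ : NonZero d}} K L →
                       count (λ k → d * d ∣? b + A * k) K L ≤ 1 + L / d / d
count-square-divides {b} {A} admissible d K L = subst (count (λ k → d * d ∣? b + A * k) K L ≤_)
  (cong suc (sym (m/n/o≡m/[n*o] L d d)))
  (count-spaced (λ k → d * d ∣? b + A * k)
    (∣-progression-spaced b A (d * d) λ k d²∣bk → coprime-square (Admissible.coprime admissible d k d²∣bk)) K L)
  where
  instance
    d²≢0 : NonZero (d * d)
    d²≢0 = m*n≢0 d d

module _ {b₁ A₁ b₂ A₂ : ℕ} (adm₁ : Admissible b₁ A₁) (adm₂ : Admissible b₂ A₂) where

  SquareDivides : ℕ → Pred ℕ 0ℓ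
  SquareDivides d k = d * d ∣ b₁ + A₁ * k ⊎ d * d ∣ b₂ + A₂ * k

  squareDivides? : ∀ d → Decidable (SquareDivides d)
  squareDivides? d k = (d * d ∣? b₁ + A₁ * k) ⊎-dec (d * d ∣? b₂ + A₂ * k)

  count-squareDivides : ∀ d .{{_ : NonZero d}} K L → count (squareDivides? d) K L ≤ 2 * (1 + L / d / d)
  count-squareDivides d K L = begin
    count (squareDivides? d) K L
      ≤⟨ count-∪ (λ k → d * d ∣? b₁ + A₁ * k) (λ k → d * d ∣? b₂ + A₂ * k) K L ⟩
    count (λ k → d * d ∣? b₁ + A₁ * k) K L + count (λ k → d * d ∣? b₂ + A₂ * k) K L
      ≤⟨ +-mono-≤ (count-square-divides adm₁ d K L) (count-square-divides adm₂ d K L) ⟩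
    (1 + L / d / d) + (1 + L / d / d)
      ≡⟨ cong (1 + L / d / d +_) (+-identityʳ (1 + L / d / d)) ⟨
    2 * (1 + L / d / d) ∎
    where open ≤-Reasoning

  open Sieve SquareDivides squareDivides? (λ e → count-squareDivides (5 + e))

  -- Sieving k ∈ [r³, 2r³) by the squares of 5, …, 2r², above which d² exceeds both values.
  ∃-squarefree-pair : ∀ N → ∃[ k ] (N ≤ k × Squarefree (b₁ + A₁ * k) × Squarefree (b₂ + A₂ * k))
  ∃-squarefree-pair N = from-window (sieve L L D (4*[2*r*r]<r*r*r r (m≤m+n 9 x)))
    where
    x r L D : ℕ
    x = A₁ + A₂ + (b₁ + b₂) + N
    r = 9 + x
    L = r * r * r
    D = 2 * (r * r)
    r≤L : r ≤ L
    r≤L = ≤-trans (m≤m*n r r) (m≤m*n (r * r) r)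
    ≤x⇒<r : ∀ {m} → m ≤ x → m < r
    ≤x⇒<r m≤x = s≤s (≤-trans m≤x (m≤n+m x 8))
    A≤x : A₁ + A₂ ≤ x
    A≤x = ≤-trans (m≤m+n (A₁ + A₂) (b₁ + b₂)) (m≤m+n _ N)
    b≤x : b₁ + b₂ ≤ x
    b≤x = ≤-trans (m≤n+m (b₁ + b₂) (A₁ + A₂)) (m≤m+n _ N)
    b₁<r : b₁ < r
    b₁<r = ≤x⇒<r (≤-trans (m≤m+n b₁ b₂) b≤x)
    b₂<r : b₂ < r
    b₂<r = ≤x⇒<r (≤-trans (m≤n+m b₂ b₁) b≤x)
    A₁≤r : A₁ ≤ r
    A₁≤r = <⇒≤ (≤x⇒<r (≤-trans (m≤m+n A₁ A₂) A≤x))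
    A₂≤r : A₂ ≤ r
    A₂≤r = <⇒≤ (≤x⇒<r (≤-trans (m≤n+m A₂ A₁) A≤x))
    5≤D : 5 ≤ D
    5≤D = ≤-trans (m≤m+n 5 4) (≤-trans (m≤m+n 9 _) (≤-trans (m≤m*n r r) (m≤m+n (r * r) _)))
    squarefree : ∀ {b A} i → b < r → A ≤ r → i < L → Admissible b A →
                 (∀ d → 5 ≤ d → d ≤ D → ¬ d * d ∣ b + A * (L + i)) → Squarefree (b + A * (L + i))
    squarefree i b<r A≤r i<L adm = squarefree-if-no-small-square D 5≤D (b+A*k<[2*r*r]² r b<r A≤r (+-monoʳ-< L i<L))
      (Admissible.4∤ adm (L + i)) (Admissible.9∤ adm (L + i))
    from-window : ∃[ i ] (i < L × ∀ d → 5 ≤ d → d ≤ D → ¬ SquareDivides d (L + i)) →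
                  ∃[ k ] (N ≤ k × Squarefree (b₁ + A₁ * k) × Squarefree (b₂ + A₂ * k))
    from-window (i , i<L , no-square) = L + i
      , ≤-trans (<⇒≤ (≤x⇒<r (m≤n+m N _))) (≤-trans r≤L (m≤m+n L i))
      , squarefree i b₁<r A₁≤r i<L adm₁ (λ d 5≤d d≤D → no-square d 5≤d d≤D ∘ inj₁)
      , squarefree i b₂<r A₂≤r i<L adm₂ (λ d 5≤d d≤D → no-square d 5≤d d≤D ∘ inj₂)

V-suc : ∀ m → V (suc m) ≡ count (regular? m) 1 (suc m)
V-suc m = length-filter-applyUpTo (regular? m) suc 1 (suc m) (+-comm 1)

V-squarefree : ∀ {m} → Squarefree m → V m ≡ m
V-squarefree {zero}  _  = refl
V-squarefree {suc m} sf = trans (V-suc m) (count-all (regular? m) 1 (suc m) λ i _ → squarefree⇒regular sf (1 + i))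

∣-spaced : ∀ n → Spaced n (n ∣_)
∣-spaced n k δ n∣k n∣k+1+δ = ∣⇒≤ (∣m+n∣m⇒∣n n∣k+1+δ n∣k)

module _ {t s} (t-prime : Prime t) (s-squarefree : Squarefree s) {m} (1+m≡t²s : suc m ≡ t * t * s) where

  private
    instance
      t≢0 : NonZero t
      t≢0 = prime⇒nonZero t-prime
      s≢0 : NonZero s
      s≢0 = squarefree⇒nonZero s-squarefree

    regular-coprime : ∀ {a} → ¬ t ∣ a → Regular (suc m) a
    regular-coprime {a} t∤a =
      subst (λ n → Regular n a) (sym 1+m≡t²s) (regular-of-coprime-prime t-prime s-squarefree t∤a)

    ¬regular-multiple : ∀ c → suc c < t → ¬ Regular (suc m) (suc c * t)
    ¬regular-multiple c 1+c<t regular =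
      <⇒≱ 1+c<t (∣⇒≤ (regular-multiple⇒∣ {t} {s} {suc c} (subst (λ n → Regular n (suc c * t)) 1+m≡t²s regular)))

  -- Every a prime to t is regular, so only the 1 + t s multiples of t can be missing.
  V-prime-square-lower : suc m ≤ V (suc m) + (1 + t * s)
  V-prime-square-lower = begin
    suc m
      ≡⟨ count-complement (t ∣?_) 1 (suc m) ⟨
    count (t ∣?_) 1 (suc m) + count (¬? ∘ (t ∣?_)) 1 (suc m)
      ≤⟨ +-mono-≤ (count-spaced (t ∣?_) (∣-spaced t) 1 (suc m))
                  (count-mono (¬? ∘ (t ∣?_)) (regular? m) regular-coprime 1 (suc m)) ⟩
    (1 + suc m / t) + count (regular? m) 1 (suc m)
      ≡⟨ cong₂ (λ q v → (1 + q) + v) [1+m]/t≡ts (sym (V-suc m)) ⟩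
    (1 + t * s) + V (suc m)
      ≡⟨ +-comm (1 + t * s) (V (suc m)) ⟩
    V (suc m) + (1 + t * s) ∎
    where
    open ≤-Reasoning
    [1+m]/t≡ts : suc m / t ≡ t * s
    [1+m]/t≡ts = trans (cong (_/ t) (trans 1+m≡t²s (solve-∀′ t s))) (m*n/n≡m (t * s) t)
      where
      solve-∀′ : ∀ t s → t * t * s ≡ t * s * t
      solve-∀′ = solve-∀

  -- t and 2 t are not regular.
  V-prime-square-upper : 3 ≤ t → V (suc m) + 2 ≤ suc m
  V-prime-square-upper 3≤t = begin
    V (suc m) + 2
      ≤⟨ +-monoʳ-≤ (V (suc m)) (count-witness₂ (¬? ∘ regular? m) 1 (suc m) t (2 * t)
           (≤-trans (s≤s z≤n) 3≤t) t<2t (s≤s 2t≤1+m)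
           (¬regular-multiple 0 (≤-trans (s≤s (s≤s z≤n)) 3≤t) ∘ subst (Regular (suc m)) (sym (*-identityˡ t)))
           (¬regular-multiple 1 3≤t)) ⟩
    V (suc m) + count (¬? ∘ regular? m) 1 (suc m)
      ≡⟨ cong (_+ count (¬? ∘ regular? m) 1 (suc m)) (V-suc m) ⟩
    count (regular? m) 1 (suc m) + count (¬? ∘ regular? m) 1 (suc m)
      ≡⟨ count-complement (regular? m) 1 (suc m) ⟩
    suc m ∎
    where
    open ≤-Reasoning
    t<2t : t < 2 * t
    t<2t = subst (t <_) (cong (t +_) (sym (+-identityʳ t))) (m<m+n t (≤-trans (s≤s z≤n) 3≤t))
    2t≤1+m : 2 * t ≤ suc m
    2t≤1+m = begin
      2 * t       ≤⟨ *-monoˡ-≤ t (≤-trans (s≤s (s≤s z≤n)) 3≤t) ⟩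
      t * t       ≤⟨ m≤m*n (t * t) s ⟩
      t * t * s   ≡⟨ 1+m≡t²s ⟨
      suc m       ∎

admissible-36 : ∀ {b} → ¬ 4 ∣ b → ¬ 9 ∣ b → Admissible b 36
admissible-36 {b} 4∤b 9∤b = record
  { 4∤ = λ k → 4∤b ∘ reduce (divides 9 refl) k
  ; 9∤ = λ k → 9∤b ∘ reduce (divides 4 refl) k
  ; coprime = λ d k d²∣f → coprime-36 (coprime-of-∤square prime[2] d²∣f (4∤b ∘ reduce (divides 9 refl) k))
                                      (coprime-of-∤square prime[3] d²∣f (9∤b ∘ reduce (divides 4 refl) k))
  }
  where
  reduce : ∀ {c} → c ∣ 36 → ∀ k → c ∣ b + 36 * k → c ∣ b
  reduce {c} c∣36 k c∣f = ∣m+n∣m⇒∣n (subst (c ∣_) (+-comm b (36 * k)) c∣f) (∣-trans c∣36 (m∣m*n k))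

∃-consecutive-squarefree : ∀ N → ∃[ n ] (N ≤ n × Squarefree n × Squarefree (suc n))
∃-consecutive-squarefree N =
  let k , N≤k , sf₁ , sf₂ = ∃-squarefree-pair (admissible-36 {1} (from-no (4 ∣? 1)) (from-no (9 ∣? 1)))
                                              (admissible-36 {2} (from-no (4 ∣? 2)) (from-no (9 ∣? 2))) N
  in 1 + 36 * k , ≤-trans N≤k (≤-trans (m≤n*m k 36) (m≤n+m (36 * k) 1)) , sf₁ , sf₂

-- n = t² (30 + 36 k) − 1, with both n and 30 + 36 k squarefree.
∃-squarefree-with-suc≡t²×squarefree : ∀ {t} → Prime t → ∀ N →
  ∃[ n ] (N ≤ n × Squarefree n × ∃[ s ] (suc n ≡ t * t * s × Squarefree s))
∃-squarefree-with-suc≡t²×squarefree {t} t-prime N =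
  let k , N≤k , s-sf , n-sf = ∃-squarefree-pair (admissible-36 {30} (from-no (4 ∣? 30)) (from-no (9 ∣? 30)))
                                                admissible-n N
  in b + A * k , ≤-trans N≤k (≤-trans (m≤n*m k A) (m≤n+m (A * k) b)) , n-sf , 30 + 36 * k , 1+n≡t²s k , s-sf
  where
  instance
    t≢0 : NonZero t
    t≢0 = prime⇒nonZero t-prime
    t²≢0 : NonZero (t * t)
    t²≢0 = m*n≢0 t t
    30t²≢0 : NonZero (30 * (t * t))
    30t²≢0 = m*n≢0 30 (t * t)
    36t²≢0 : NonZero (36 * (t * t))
    36t²≢0 = m*n≢0 36 (t * t)
  b A : ℕ
  b = 30 * (t * t) ∸ 1
  A = 36 * (t * t)
  1+n≡t²s : ∀ k → suc (b + A * k) ≡ t * t * (30 + 36 * k)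
  1+n≡t²s k = trans (cong (_+ A * k) (suc-pred (30 * (t * t)))) (distrib t k)
    where
    distrib : ∀ t k → 30 * (t * t) + 36 * (t * t) * k ≡ t * t * (30 + 36 * k)
    distrib = solve-∀
  divides-suc : ∀ {p} → p ∣ 30 → p ∣ 36 → ∀ k → p ∣ suc (b + A * k)
  divides-suc {p} p∣30 p∣36 k = subst (p ∣_) (sym (1+n≡t²s k))
    (∣n⇒∣m*n (t * t) (∣m∣n⇒∣m+n p∣30 (∣-trans p∣36 (m∣m*n k))))
  admissible-n : Admissible b A
  admissible-n = record
    { 4∤ = λ k 4∣n → ∤-of-∣suc prime[2] (divides-suc (divides 15 refl) (divides 18 refl) k) (∣-trans (divides 2 refl) 4∣n)
    ; 9∤ = λ k 9∣n → ∤-of-∣suc prime[3] (divides-suc (divides 10 refl) (divides 12 refl) k) (∣-trans (divides 3 refl) 9∣n)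
    ; coprime = λ d k d²∣n →
        let d⊥t = coprime-of-∣suc t-prime (subst (t ∣_) (sym (1+n≡t²s k)) (∣-trans (m∣m*n t) (m∣m*n _))) d²∣n
        in coprime-* (coprime-36 (coprime-of-∣suc prime[2] (divides-suc (divides 15 refl) (divides 18 refl) k) d²∣n)
                                  (coprime-of-∣suc prime[3] (divides-suc (divides 10 refl) (divides 12 refl) k) d²∣n))
                     (coprime-* d⊥t d⊥t)
    }

-- Euclid: every prime factor of B! + 1 exceeds B.
∃-prime> : ∀ B → ∃[ p ] (B < p × Prime p)
∃-prime> B = larger-factor (factors F) (isFactorisation F) (factorsPrime F)
  where
  open PrimeFactorisation
  F : PrimeFactorisation (suc (B !))
  F = factorise (suc (B !))
  larger-factor : ∀ ps → suc (B !) ≡ product ps → All Prime ps → ∃[ p ] (B < p × Prime p)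
  larger-factor [] 1+B!≡1 _ = ⊥-elim (≢-nonZero⁻¹ (B !) {{B !≢0}} (suc-injective 1+B!≡1))
  larger-factor (p ∷ ps) 1+B!≡Πps (p-prime ∷ _) with B <? p
  ... | yes B<p = p , B<p , p-prime
  ... | no  B≮p = ⊥-elim (∤-of-∣suc p-prime (subst (p ∣_) (sym 1+B!≡Πps) (m∣m*n (product ps)))
                                           (m≤n⇒m∣n! {{prime⇒nonZero p-prime}} (≮⇒≥ B≮p)))

-- (4 + j) u ≤ t u = n + 1 ≤ W + 1 + u leaves W ≥ j u + 2.
n*j<W*[1+j] : ∀ {n W t u j} → suc n ≡ t * u → 1 ≤ u → 4 + j ≤ t → suc n ≤ suc W + u → n * j < W * suc j
n*j<W*[1+j] {n} {W} {t} {u} {j} 1+n≡tu 1≤u 4+j≤t 1+n≤1+W+u = begin-strict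
  n * j           ≤⟨ *-monoˡ-≤ j (≤-pred 1+n≤1+W+u) ⟩
  (W + u) * j     ≡⟨ *-distribʳ-+ j W u ⟩
  W * j + u * j   <⟨ +-monoʳ-< (W * j) uj<W ⟩
  W * j + W       ≡⟨ trans (*-suc W j) (+-comm W (W * j)) ⟨
  W * suc j       ∎
  where
  open ≤-Reasoning
  regroup : ∀ u j → u * j + 3 * u + u ≡ (4 + j) * u
  regroup = solve-∀
  3+uj≤uj+3u : 3 + u * j ≤ u * j + 3 * u
  3+uj≤uj+3u = subst (_≤ u * j + 3 * u) (+-comm (u * j) 3) (+-monoʳ-≤ (u * j) (*-monoʳ-≤ 3 1≤u))
  uj+3u≤1+W : u * j + 3 * u ≤ suc W
  uj+3u≤1+W = +-cancelʳ-≤ u _ _ (begin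
    u * j + 3 * u + u  ≡⟨ regroup u j ⟩
    (4 + j) * u        ≤⟨ *-monoˡ-≤ u 4+j≤t ⟩
    t * u              ≡⟨ 1+n≡tu ⟨
    suc n              ≤⟨ 1+n≤1+W+u ⟩
    suc W + u          ∎)
  uj<W : u * j < W
  uj<W = ≤-trans (n≤1+n _) (≤-pred (≤-trans 3+uj≤uj+3u uj+3u≤1+W))

V-ratio-above-one : ∀ j N → ∃[ n ] (n ≥ N × V n < V (suc n) × V (suc n) * suc j < V n * suc (suc j))
V-ratio-above-one j N = conclude (∃-consecutive-squarefree (2 + j + N))
  where
  conclude : ∃[ n ] (2 + j + N ≤ n × Squarefree n × Squarefree (suc n)) →
             ∃[ n ] (n ≥ N × V n < V (suc n) × V (suc n) * suc j < V n * suc (suc j))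
  conclude (n , 2+j+N≤n , n-sf , 1+n-sf) =
    n , ≤-trans (m≤n+m N (2 + j)) 2+j+N≤n
      , subst₂ _<_ (sym Vn≡n) (sym V[1+n]≡1+n) (n<1+n n)
      , subst₂ (λ v w → w * suc j < v * suc (suc j)) (sym Vn≡n) (sym V[1+n]≡1+n) (begin-strict
          suc n * suc j      <⟨ +-monoˡ-< (n * suc j) (≤-trans (m≤m+n (2 + j) N) 2+j+N≤n) ⟩
          n + n * suc j      ≡⟨ *-suc n (suc j) ⟨
          n * suc (suc j)    ∎)
    where
    open ≤-Reasoning
    Vn≡n : V n ≡ n
    Vn≡n = V-squarefree n-sf
    V[1+n]≡1+n : V (suc n) ≡ suc n
    V[1+n]≡1+n = V-squarefree 1+n-sf

V-ratio-below-one : ∀ j N → ∃[ n ] (n ≥ N × V (suc n) < V n × V n * j < V (suc n) * suc j)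
V-ratio-below-one j N = conclude (∃-prime> (3 + j))
  where
  near-t² : ∀ t → 3 + j < t → Prime t → ∃[ n ] (N ≤ n × Squarefree n × ∃[ s ] (suc n ≡ t * t * s × Squarefree s)) →
            ∃[ n ] (n ≥ N × V (suc n) < V n × V n * j < V (suc n) * suc j)
  near-t² t 4+j≤t t-prime (n , N≤n , n-sf , s , 1+n≡t²s , s-sf) =
    n , N≤n , subst (W <_) (sym Vn≡n) W<n
      , subst (λ v → v * j < W * suc j) (sym Vn≡n)
          (n*j<W*[1+j] (trans 1+n≡t²s (*-assoc t t s)) 1≤u 4+j≤t 1+n≤1+W+u)
    where
    W u : ℕ
    W = V (suc n)
    u = t * s
    Vn≡n : V n ≡ n
    Vn≡n = V-squarefree n-sf
    3≤t : 3 ≤ t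
    3≤t = ≤-trans (s≤s (s≤s (s≤s z≤n))) (≤-trans (m≤m+n 4 j) 4+j≤t)
    W<n : W < n
    W<n = ≤-pred (subst (_≤ suc n) (+-comm W 2) (V-prime-square-upper t-prime s-sf 1+n≡t²s 3≤t))
    1+n≤1+W+u : suc n ≤ suc W + u
    1+n≤1+W+u = subst (suc n ≤_) (+-suc W u) (V-prime-square-lower t-prime s-sf 1+n≡t²s)
    1≤u : 1 ≤ u
    1≤u = >-nonZero⁻¹ u {{m*n≢0 t s {{prime⇒nonZero t-prime}} {{squarefree⇒nonZero s-sf}}}}

  conclude : ∃[ t ] (3 + j < t × Prime t) → ∃[ n ] (n ≥ N × V (suc n) < V n × V n * j < V (suc n) * suc j)
  conclude (t , 4+j≤t , t-prime) = near-t² t 4+j≤t t-prime (∃-squarefree-with-suc≡t²×squarefree t-prime N)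

proposition2 :
    ((j N : ℕ) → ∃[ n ] (n ≥ N × V n < V (suc n) × V (suc n) * suc j < V n * suc (suc j)))
    × ((j N : ℕ) → ∃[ n ] (n ≥ N × V (suc n) < V n × V n * j < V (suc n) * suc j))
proposition2 = V-ratio-above-one , V-ratio-below-one
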